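{- Let $\mathsf{L}$ be an intermediate logic with $\mathsf{ND}\subseteq\mathsf{L}$, and let $\mathcal{ST}$ be the set of substitutions that are stable in $\mathsf{L}^\neg$. Then $\mathsf{L}^\neg$ is $\mathcal{ST}$-hereditarily structurally complete: for every intermediate theory $\mathsf{T}$ with $\mathsf{L}^\neg\subseteq\mathsf{T}$ such that $\vdash_{\mathsf{T}}$ is closed under every $\sigma\in\mathcal{ST}$, and for all formulas $\phi,\psi$: if for every $\sigma\in\mathcal{ST}$, $\vdash_{\mathsf{T}}\sigma(\phi)$ implies $\vdash_{\mathsf{T}}\sigma(\psi)$, then $\phi\vdash_{\mathsf{T}}\psi$. In particular this holds for $\mathsf{ND}^\neg$, $\mathsf{KP}^\neg$ and $\mathsf{ML}^\neg$.
   Context: Formulas are those of intuitionistic propositional logic $\mathsf{IPC}$ (built from propositional variables, $\bot,\top$ with $\wedge,\vee,\to$; $\neg\phi:=\phi\to\bot$). An intermediate theory is a set $\mathsf{T}$ of formulas closed under modus ponens with $\mathsf{IPC}\subseteq\mathsf{T}\subseteq\mathsf{CPC}$; an intermediate logic is an intermediate theory closed under uniform substitution. For an intermediate theory $\mathsf{T}$, $\Gamma\vdash_{\mathsf{T}}\phi$ means $\phi$ is derivable from $\mathsf{T}\cup\Gamma$ by modus ponens, and $\vdash_{\mathsf{T}}\phi$ means $\phi\in\mathsf{T}$. A substitution is a map on formulas commuting with connectives (determined by its values on variables). $\vdash_{\mathsf{T}}$ is closed under $\sigma$ if $\phi\vdash_{\mathsf{T}}\psi$ implies $\sigma(\phi)\vdash_{\mathsf{T}}\sigma(\psi)$.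 For an intermediate logic $\mathsf{L}$, its negative variant is $\mathsf{L}^\neg=\{\phi\mid\phi^\neg\in\mathsf{L}\}$, where $\phi^\neg$ is obtained from $\phi$ by replacing every propositional variable $p$ by $\neg p$. A substitution $\sigma$ is stable in $\mathsf{L}^\neg$ if $\vdash_{\mathsf{L}^\neg}\sigma(p)\leftrightarrow\neg\neg\sigma(p)$ for every variable $p$. $\mathsf{ND}$ is the smallest intermediate logic containing all instances of $(\neg\phi\to\bigvee_{i=1}^k\neg\psi_i)\to\bigvee_{i=1}^k(\neg\phi\to\neg\psi_i)$ for all $k\geq1$; $\mathsf{KP}$ (Kreisel–Putnam logic) is the smallest intermediate logic containing all instances of $(\neg\phi\to\psi\vee\chi)\to(\neg\phi\to\psi)\vee(\neg\phi\to\chi)$; $\mathsf{ML}$ (Medvedev's logic) is the set of formulas valid in all Kripke frames of the form $(\{Y\subseteq S: Y\neq\emptyset\},\supseteq)$ with $S$ a finite nonempty set. It is known that $\mathsf{ND}\subseteq\mathsf{KP}\subseteq\mathsf{ML}$. -}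

module Defs where

open import Data.Nat using (ℕ)
open import Data.Bool using (Bool; true; false; _∧_; _∨_; not)
open import Data.List using (List; []; _∷_)
open import Data.Product using (_×_)
open import Relation.Binary.PropositionalEquality using (_≡_)
open import Relation.Unary using (Pred; _⊆_)
open import Level using (0ℓ)

infixr 6 _∧'_
infixr 5 _∨'_
infixr 4 _⇒_

data Fm : Set where
  var  : ℕ → Fm
  ⊥'   : Fm
  ⊤'   : Fm
  _∧'_ : Fm → Fm → Fm
  _∨'_ : Fm → Fm → Fm
  _⇒_  : Fm → Fm → Fm

¬' : Fm → Fm
¬' φ = φ ⇒ ⊥'

_⇔_ : Fm → Fm → Fm
φ ⇔ ψ = (φ ⇒ ψ) ∧' (ψ ⇒ φ)

FmSet : Set₁
FmSet = Pred Fm 0ℓ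

Subst : Set
Subst = ℕ → Fm

sub : Subst → Fm → Fm
sub σ (var p)  = σ p
sub σ ⊥'       = ⊥'
sub σ ⊤'       = ⊤'
sub σ (φ ∧' ψ) = sub σ φ ∧' sub σ ψ
sub σ (φ ∨' ψ) = sub σ φ ∨' sub σ ψ
sub σ (φ ⇒ ψ)  = sub σ φ ⇒ sub σ ψ

data IPCAxiom : Fm → Set where
  ax-K    : ∀ A B → IPCAxiom (A ⇒ B ⇒ A)
  ax-S    : ∀ A B C → IPCAxiom ((A ⇒ B ⇒ C) ⇒ (A ⇒ B) ⇒ A ⇒ C)
  ax-∧E₁  : ∀ A B → IPCAxiom (A ∧' B ⇒ A)
  ax-∧E₂  : ∀ A B → IPCAxiom (A ∧' B ⇒ B)
  ax-∧I   : ∀ A B → IPCAxiom (A ⇒ B ⇒ A ∧' B)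
  ax-∨I₁  : ∀ A B → IPCAxiom (A ⇒ A ∨' B)
  ax-∨I₂  : ∀ A B → IPCAxiom (B ⇒ A ∨' B)
  ax-∨E   : ∀ A B C → IPCAxiom ((A ⇒ C) ⇒ (B ⇒ C) ⇒ A ∨' B ⇒ C)
  ax-⊥E   : ∀ A → IPCAxiom (⊥' ⇒ A)
  ax-⊤I   : IPCAxiom ⊤'

data IPC : Fm → Set where
  ipc-ax : ∀ {φ} → IPCAxiom φ → IPC φ
  ipc-mp : ∀ {φ ψ} → IPC (φ ⇒ ψ) → IPC φ → IPC ψ

eval : (ℕ → Bool) → Fm → Bool
eval v (var p)  = v p
eval v ⊥'       = false
eval v ⊤'       = true
eval v (φ ∧' ψ) = eval v φ ∧ eval v ψ
eval v (φ ∨' ψ) = eval v φ ∨ eval v ψ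
eval v (φ ⇒ ψ)  = not (eval v φ) ∨ eval v ψ

CPC : FmSet
CPC φ = ∀ (v : ℕ → Bool) → eval v φ ≡ true

record IntermediateTheory (T : FmSet) : Set where
  field
    mp-closed : ∀ {φ ψ} → T (φ ⇒ ψ) → T φ → T ψ
    ipc⊆      : IPC ⊆ T
    ⊆cpc      : T ⊆ CPC

record IntermediateLogic (L : FmSet) : Set where
  field
    theory      : IntermediateTheory L
    subst-closed : ∀ (σ : Subst) {φ} → L φ → L (sub σ φ)

data _,_⊢_ (T : FmSet) (Γ : FmSet) : Fm → Set where
  from-T : ∀ {φ} → T φ → T , Γ ⊢ φ
  from-Γ : ∀ {φ} → Γ φ → T , Γ ⊢ φ
  mp     : ∀ {φ ψ} → T , Γ ⊢ (φ ⇒ ψ) → T , Γ ⊢ φ → T , Γ ⊢ ψ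

_⊢[_]_ : Fm → FmSet → Fm → Set
φ ⊢[ T ] ψ = T , (λ χ → χ ≡ φ) ⊢ ψ

ClosedUnder : FmSet → Subst → Set
ClosedUnder T σ = ∀ φ ψ → φ ⊢[ T ] ψ → sub σ φ ⊢[ T ] sub σ ψ

-- Big disjunction of a nonempty list ψ₁ , ψs  (k = 1 + length ψs)
⋁ : Fm → List Fm → Fm
⋁ ψ []        = ψ
⋁ ψ (χ ∷ χs)  = ψ ∨' ⋁ χ χs

⋁map : (Fm → Fm) → Fm → List Fm → Fm
⋁map f ψ []       = f ψ
⋁map f ψ (χ ∷ χs) = f ψ ∨' ⋁map f χ χs

NDAxiom : Fm → Fm → List Fm → Fm
NDAxiom φ ψ ψs =
  (¬' φ ⇒ ⋁map ¬' ψ ψs) ⇒ ⋁map (λ χ → ¬' φ ⇒ ¬' χ) ψ ψs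

-- ND: the smallest intermediate logic containing all ND axiom instances
-- (inductive closure of IPC ∪ ND-axioms under modus ponens and substitution)
data ND : Fm → Set where
  nd-ipc : ∀ {φ} → IPC φ → ND φ
  nd-ax  : ∀ φ ψ ψs → ND (NDAxiom φ ψ ψs)
  nd-mp  : ∀ {φ ψ} → ND (φ ⇒ ψ) → ND φ → ND ψ
  nd-sub : ∀ (σ : Subst) {φ} → ND φ → ND (sub σ φ)

neg : Fm → Fm
neg = sub (λ p → ¬' (var p))

_⁻ : FmSet → FmSet
(L ⁻) φ = L (neg φ)

Stable : FmSet → Subst → Set
Stable L σ = ∀ p → (L ⁻) (σ p ⇔ ¬' (¬' (σ p)))

-- Every formula φ is ND¬-equivalent to the disjunction of its resolutions, which are
-- ∨-free: the ND axioms, applied to double negations, distribute an implication with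
-- ∨-free antecedent over a disjunction, because ∨-free formulas are ¬¬-stable once
-- the variables are. So it suffices to derive α → ψ in T for every resolution α of φ.
-- If α is classically unsatisfiable, Kalmár's lemma gives IPC ⊢ ¬α. Otherwise pick
-- v ⊨ α and let θ map p to α → p if v(p) holds and to α ∧ p if not. Then θ is stable,
-- θ(α) is an ∨-free classical tautology and hence a theorem, and α ⊢ θ(χ) ↔ χ for
-- every χ. From α ⊢_T φ we get ⊢_T θ(φ), so ⊢_T θ(ψ) by hypothesis, and α ⊢_T ψ.
module Submission where

open import Defs
open import Relation.Unary using (_⊆_)
open import Data.Nat using (ℕ; _≟_)
open import Data.Bool using (Bool; true; false; _∧_; _∨_; not)
open import Data.List using (List; []; _∷_; map; _++_; cartesianProductWith)
open import Data.List.Membership.Propositional using (_∈_)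
open import Data.List.Membership.Propositional.Properties
  using (∈-map⁻; ∈-++⁺ˡ; ∈-++⁺ʳ; ∈-++⁻; ∈-cartesianProductWith⁺; ∈-cartesianProductWith⁻)
open import Data.List.Relation.Unary.Any using (here; there)
open import Data.Product using (∃; ∃-syntax; _×_; _,_; proj₁; zip′)
open import Data.Sum using (_⊎_; inj₁; inj₂; [_,_]′; map₂)
open import Function using (id)
open import Relation.Binary.PropositionalEquality using (_≡_; refl; sym; trans; cong₂; subst)
open import Relation.Nullary using (yes; no; contradiction)

private
  variable
    Γ Δ : List Fm
    A B C α φ ψ χ : Fm

¬¬ : Fm → Fm
¬¬ φ = ¬' (¬' φ)

vars : Fm → List ℕ
vars (var p)  = p ∷ []
vars ⊥'       = []
vars ⊤'       = []
vars (A ∧' B) = vars A ++ vars B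
vars (A ∨' B) = vars A ++ vars B
vars (A ⇒ B)  = vars A ++ vars B

IPC-sub : ∀ σ {φ} → IPC φ → IPC (sub σ φ)
IPC-sub σ (ipc-mp d e)               = ipc-mp (IPC-sub σ d) (IPC-sub σ e)
IPC-sub σ (ipc-ax (ax-K A B))        = ipc-ax (ax-K _ _)
IPC-sub σ (ipc-ax (ax-S A B C))      = ipc-ax (ax-S _ _ _)
IPC-sub σ (ipc-ax (ax-∧E₁ A B))      = ipc-ax (ax-∧E₁ _ _)
IPC-sub σ (ipc-ax (ax-∧E₂ A B))      = ipc-ax (ax-∧E₂ _ _)
IPC-sub σ (ipc-ax (ax-∧I A B))       = ipc-ax (ax-∧I _ _)
IPC-sub σ (ipc-ax (ax-∨I₁ A B))      = ipc-ax (ax-∨I₁ _ _)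
IPC-sub σ (ipc-ax (ax-∨I₂ A B))      = ipc-ax (ax-∨I₂ _ _)
IPC-sub σ (ipc-ax (ax-∨E A B C))     = ipc-ax (ax-∨E _ _ _)
IPC-sub σ (ipc-ax (ax-⊥E A))         = ipc-ax (ax-⊥E _)
IPC-sub σ (ipc-ax ax-⊤I)             = ipc-ax ax-⊤I

⇒-consequence : ∀ {T φ ψ} → T (φ ⇒ ψ) → φ ⊢[ T ] ψ
⇒-consequence T⊢φ⇒ψ = mp (from-T T⊢φ⇒ψ) (from-Γ refl)

discharge-premise : ∀ {T φ ψ} → IntermediateTheory T → T φ → φ ⊢[ T ] ψ → T ψ
discharge-premise T-theory T⊢φ (from-T T⊢ψ) = T⊢ψ
discharge-premise T-theory T⊢φ (from-Γ refl) = T⊢φ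
discharge-premise T-theory T⊢φ (mp d e) =
  IntermediateTheory.mp-closed T-theory
    (discharge-premise T-theory T⊢φ d) (discharge-premise T-theory T⊢φ e)

Satisfiable : Fm → Set
Satisfiable χ = ∃ λ v → eval v χ ≡ true

eval-cong : ∀ {v w} → (∀ p → v p ≡ w p) → ∀ χ → eval v χ ≡ eval w χ
eval-cong v≗w (var p)  = v≗w p
eval-cong v≗w ⊥'       = refl
eval-cong v≗w ⊤'       = refl
eval-cong v≗w (A ∧' B) = cong₂ _∧_ (eval-cong v≗w A) (eval-cong v≗w B)
eval-cong v≗w (A ∨' B) = cong₂ _∨_ (eval-cong v≗w A) (eval-cong v≗w B)
eval-cong v≗w (A ⇒ B)  = cong₂ (λ a b → not a ∨ b) (eval-cong v≗w A) (eval-cong v≗w B)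

eval-sub : ∀ w σ χ → eval w (sub σ χ) ≡ eval (λ p → eval w (σ p)) χ
eval-sub w σ (var p)  = refl
eval-sub w σ ⊥'       = refl
eval-sub w σ ⊤'       = refl
eval-sub w σ (A ∧' B) = cong₂ _∧_ (eval-sub w σ A) (eval-sub w σ B)
eval-sub w σ (A ∨' B) = cong₂ _∨_ (eval-sub w σ A) (eval-sub w σ B)
eval-sub w σ (A ⇒ B)  = cong₂ (λ a b → not a ∨ b) (eval-sub w σ A) (eval-sub w σ B)

signed : Bool → Fm → Fm
signed true  χ = χ
signed false χ = ¬' χ

Assignment : Set
Assignment = List (ℕ × Bool)

domain : Assignment → List ℕ
domain = map proj₁

literals : Assignment → List Fm
literals = map (λ (p , b) → signed b (var p))

-- Later entries are shadowed by earlier ones; unassigned variables default to true.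
valuation : Assignment → ℕ → Bool
valuation [] p = true
valuation ((q , b) ∷ as) p with q ≟ p
... | yes _ = b
... | no  _ = valuation as p

literal-∈ : ∀ as {p} → p ∈ domain as → signed (valuation as p) (var p) ∈ literals as
literal-∈ ((q , b) ∷ as) {p} p∈ with q ≟ p
... | yes refl = here refl
literal-∈ ((q , b) ∷ as) (here p≡q)  | no q≢p = contradiction (sym p≡q) q≢p
literal-∈ ((q , b) ∷ as) (there p∈) | no q≢p = there (literal-∈ as p∈)

move-head : ∀ {A : Set} {x y : A} {xs ys} → x ∈ y ∷ xs ⊎ x ∈ ys → x ∈ xs ⊎ x ∈ y ∷ ys
move-head (inj₁ (here x≡y))  = inj₂ (here x≡y)
move-head (inj₁ (there x∈))  = inj₁ x∈
move-head (inj₂ x∈)          = inj₂ (there x∈)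

data OrFree : Fm → Set where
  var  : ∀ p → OrFree (var p)
  ⊥'   : OrFree ⊥'
  ⊤'   : OrFree ⊤'
  _∧'_ : ∀ {A B} → OrFree A → OrFree B → OrFree (A ∧' B)
  _⇒_  : ∀ {A B} → OrFree A → OrFree B → OrFree (A ⇒ B)

sub-OrFree : ∀ σ {χ} → (∀ p → OrFree (σ p)) → OrFree χ → OrFree (sub σ χ)
sub-OrFree σ σ-free (var p)  = σ-free p
sub-OrFree σ σ-free ⊥'       = ⊥'
sub-OrFree σ σ-free ⊤'       = ⊤'
sub-OrFree σ σ-free (a ∧' b) = sub-OrFree σ σ-free a ∧' sub-OrFree σ σ-free b
sub-OrFree σ σ-free (a ⇒ b)  = sub-OrFree σ σ-free a ⇒ sub-OrFree σ σ-free b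

guard : Bool → Fm → Fm → Fm
guard true  α χ = α ⇒ χ
guard false α χ = α ∧' χ

θ : (ℕ → Bool) → Fm → Subst
θ v α p = guard (v p) α (var p)

θ-OrFree : ∀ v {α} → OrFree α → ∀ p → OrFree (θ v α p)
θ-OrFree v α-free p with v p
... | true  = α-free ⇒ var p
... | false = α-free ∧' var p

θ-value-if : ∀ w v α p → eval w α ≡ true → eval w (θ v α p) ≡ w p
θ-value-if w v α p w⊨α with v p
... | true  rewrite w⊨α = refl
... | false rewrite w⊨α = refl

θ-value-if-not : ∀ w v α p → eval w α ≡ false → eval w (θ v α p) ≡ v p
θ-value-if-not w v α p w⊭α with v p
... | true  rewrite w⊭α = refl
... | false rewrite w⊭α = refl

θ-unifies : ∀ v α → eval v α ≡ true → CPC (sub (θ v α) α)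
θ-unifies v α v⊨α w with eval w α in w⊨α
... | true  = trans (eval-sub w (θ v α) α)
                (trans (eval-cong (λ p → θ-value-if w v α p w⊨α) α) w⊨α)
... | false = trans (eval-sub w (θ v α) α)
                (trans (eval-cong (λ p → θ-value-if-not w v α p w⊨α) α) v⊨α)

-- All conjunctions ⋀_{a ∈ as} (a ⇒ f a) for the choice functions f : as → bs.
choices : List Fm → List Fm → List Fm
choices []       bs = ⊤' ∷ []
choices (a ∷ as) bs = cartesianProductWith (λ b c → (a ⇒ b) ∧' c) bs (choices as bs)

-- ⊥' keeps the list of consequents nonempty, as the ND axioms need k ≥ 1.
resolutions : Fm → List Fm
resolutions (var p)  = var p ∷ []
resolutions ⊥'       = ⊥' ∷ []
resolutions ⊤'       = ⊤' ∷ []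
resolutions (A ∧' B) = cartesianProductWith _∧'_ (resolutions A) (resolutions B)
resolutions (A ∨' B) = resolutions A ++ resolutions B
resolutions (A ⇒ B)  = choices (resolutions A) (⊥' ∷ resolutions B)

choices-OrFree : ∀ as {bs x} → (∀ {a} → a ∈ as → OrFree a) → (∀ {b} → b ∈ bs → OrFree b) →
                 x ∈ choices as bs → OrFree x
choices-OrFree []       as-free bs-free (here refl) = ⊤'
choices-OrFree (a ∷ as) {bs} as-free bs-free x∈
  with b , c , b∈ , c∈ , refl ← ∈-cartesianProductWith⁻ _ bs (choices as bs) x∈ =
  (as-free (here refl) ⇒ bs-free b∈) ∧' choices-OrFree as (λ a∈ → as-free (there a∈)) bs-free c∈

resolutions-OrFree : ∀ φ {α} → α ∈ resolutions φ → OrFree α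
consequents-OrFree : ∀ φ {α} → α ∈ ⊥' ∷ resolutions φ → OrFree α

resolutions-OrFree (var p) (here refl) = var p
resolutions-OrFree ⊥'      (here refl) = ⊥'
resolutions-OrFree ⊤'      (here refl) = ⊤'
resolutions-OrFree (A ∧' B) α∈
  with x , y , x∈ , y∈ , refl ← ∈-cartesianProductWith⁻ _∧'_ (resolutions A) (resolutions B) α∈ =
  resolutions-OrFree A x∈ ∧' resolutions-OrFree B y∈
resolutions-OrFree (A ∨' B) α∈ =
  [ resolutions-OrFree A , resolutions-OrFree B ]′ (∈-++⁻ (resolutions A) α∈)
resolutions-OrFree (A ⇒ B) α∈ =
  choices-OrFree (resolutions A) (resolutions-OrFree A) (consequents-OrFree B) α∈

consequents-OrFree φ (here refl) = ⊥'
consequents-OrFree φ (there α∈)  = resolutions-OrFree φ α∈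

module Derivations (S : FmSet) where

  infix  3 _⊩_
  infixl 5 _·_

  data _⊩_ (Γ : List Fm) : Fm → Set where
    hyp   : ∀ {φ} → φ ∈ Γ → Γ ⊩ φ
    axiom : ∀ {φ} → IPCAxiom φ → Γ ⊩ φ
    extra : ∀ {φ} → S φ → Γ ⊩ φ
    _·_   : ∀ {φ ψ} → Γ ⊩ φ ⇒ ψ → Γ ⊩ φ → Γ ⊩ ψ

  derivable⇒member : (∀ {φ ψ} → S (φ ⇒ ψ) → S φ → S ψ) → IPC ⊆ S → [] ⊩ φ → S φ
  derivable⇒member S-mp IPC⊆S (axiom a) = IPC⊆S (ipc-ax a)
  derivable⇒member S-mp IPC⊆S (extra s) = s
  derivable⇒member S-mp IPC⊆S (d · e)   =
    S-mp (derivable⇒member S-mp IPC⊆S d) (derivable⇒member S-mp IPC⊆S e)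

  weaken : (∀ {x} → x ∈ Γ → x ∈ Δ) → Γ ⊩ φ → Δ ⊩ φ
  weaken Γ⊆Δ (hyp φ∈)  = hyp (Γ⊆Δ φ∈)
  weaken Γ⊆Δ (axiom a) = axiom a
  weaken Γ⊆Δ (extra s) = extra s
  weaken Γ⊆Δ (d · e)   = weaken Γ⊆Δ d · weaken Γ⊆Δ e

  weaken₁ : Γ ⊩ φ → A ∷ Γ ⊩ φ
  weaken₁ = weaken there

  weaken₂ : Γ ⊩ φ → A ∷ B ∷ Γ ⊩ φ
  weaken₂ = weaken (λ x∈ → there (there x∈))

  #0 : A ∷ Γ ⊩ A
  #0 = hyp (here refl)

  #1 : A ∷ B ∷ Γ ⊩ B
  #1 = hyp (there (here refl))

  #2 : A ∷ B ∷ C ∷ Γ ⊩ C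
  #2 = hyp (there (there (here refl)))

  I : Γ ⊩ A ⇒ A
  I {A = A} = axiom (ax-S A (A ⇒ A) A) · axiom (ax-K A (A ⇒ A)) · axiom (ax-K A A)

  ⇒I : A ∷ Γ ⊩ B → Γ ⊩ A ⇒ B
  ⇒I (hyp (here refl)) = I
  ⇒I (hyp (there B∈))  = axiom (ax-K _ _) · hyp B∈
  ⇒I (axiom a)         = axiom (ax-K _ _) · axiom a
  ⇒I (extra s)         = axiom (ax-K _ _) · extra s
  ⇒I (d · e)           = axiom (ax-S _ _ _) · ⇒I d · ⇒I e

  ∧I : Γ ⊩ A → Γ ⊩ B → Γ ⊩ A ∧' B
  ∧I a b = axiom (ax-∧I _ _) · a · b

  ∧E₁ : Γ ⊩ A ∧' B → Γ ⊩ A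
  ∧E₁ d = axiom (ax-∧E₁ _ _) · d

  ∧E₂ : Γ ⊩ A ∧' B → Γ ⊩ B
  ∧E₂ d = axiom (ax-∧E₂ _ _) · d

  ∨I₁ : Γ ⊩ A → Γ ⊩ A ∨' B
  ∨I₁ d = axiom (ax-∨I₁ _ _) · d

  ∨I₂ : Γ ⊩ B → Γ ⊩ A ∨' B
  ∨I₂ d = axiom (ax-∨I₂ _ _) · d

  ∨E : Γ ⊩ A ∨' B → A ∷ Γ ⊩ C → B ∷ Γ ⊩ C → Γ ⊩ C
  ∨E d l r = axiom (ax-∨E _ _ _) · ⇒I l · ⇒I r · d

  ⊥E : Γ ⊩ ⊥' → Γ ⊩ A
  ⊥E d = axiom (ax-⊥E _) · d

  ⊤I : Γ ⊩ ⊤'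
  ⊤I = axiom ax-⊤I

  ¬¬I : Γ ⊩ A ⇒ ¬¬ A
  ¬¬I = ⇒I (⇒I (#0 · #1))

  ¬¬-map : Γ ⊩ (A ⇒ B) ⇒ ¬¬ A ⇒ ¬¬ B
  ¬¬-map = ⇒I (⇒I (⇒I (#1 · ⇒I (#1 · (hyp (there (there (there (here refl)))) · #0)))))

  ¬¬¬⇒¬ : Γ ⊩ ¬¬ (¬' A) ⇒ ¬' A
  ¬¬¬⇒¬ = ⇒I (⇒I (#1 · (¬¬I · #0)))

  ¬-by-cases : A ∷ Γ ⊩ ¬' C → ¬' A ∷ Γ ⊩ ¬' C → Γ ⊩ ¬' C
  ¬-by-cases l r = ⇒I (¬¬-excluded-middle · ⇒I (∨E #0 (keep-head l · #2) (keep-head r · #2)))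
    where
      ¬¬-excluded-middle : Δ ⊩ ¬¬ (A ∨' ¬' A)
      ¬¬-excluded-middle = ⇒I (#0 · ∨I₂ (⇒I (#1 · ∨I₁ #0)))

      keep-head : ∀ {D E F} → D ∷ Γ ⊩ φ → D ∷ E ∷ F ∷ Γ ⊩ φ
      keep-head = weaken λ { (here e) → here e ; (there x∈) → there (there (there x∈)) }

  ∧-mono : Γ ⊩ A ⇒ B → Γ ⊩ C ⇒ χ → Γ ⊩ A ∧' C ⇒ B ∧' χ
  ∧-mono f g = ⇒I (∧I (weaken₁ f · ∧E₁ #0) (weaken₁ g · ∧E₂ #0))

  ∨-mono : Γ ⊩ A ⇒ B → Γ ⊩ C ⇒ χ → Γ ⊩ A ∨' C ⇒ B ∨' χ
  ∨-mono f g = ⇒I (∨E #0 (∨I₁ (weaken₂ f · #0)) (∨I₂ (weaken₂ g · #0)))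

  ⇒-mono : Γ ⊩ B ⇒ A → Γ ⊩ C ⇒ χ → Γ ⊩ (A ⇒ C) ⇒ (B ⇒ χ)
  ⇒-mono f g = ⇒I (⇒I (weaken₂ g · (#1 · (weaken₂ f · #0))))

  disj : List Fm → Fm
  disj []       = ⊥'
  disj (x ∷ xs) = x ∨' disj xs

  disj-intro : ∀ {x xs} → x ∈ xs → Γ ⊩ x ⇒ disj xs
  disj-intro (here refl) = ⇒I (∨I₁ #0)
  disj-intro (there x∈)  = ⇒I (∨I₂ (disj-intro x∈ · #0))

  disj-elim : ∀ {xs} → (∀ {x} → x ∈ xs → Γ ⊩ x ⇒ C) → Γ ⊩ disj xs ⇒ C
  disj-elim {xs = []}     f = ⇒I (⊥E #0)
  disj-elim {xs = x ∷ xs} f =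
    ⇒I (∨E #0 (weaken₂ (f (here refl)) · #0) (weaken₂ (disj-elim (λ x∈ → f (there x∈))) · #0))

  disj-elim₂ : ∀ {xs ys} → (∀ {x y} → x ∈ xs → y ∈ ys → Γ ⊩ x ⇒ y ⇒ C) → Γ ⊩ disj xs ⇒ disj ys ⇒ C
  disj-elim₂ f = disj-elim λ x∈ → ⇒I (disj-elim λ y∈ → ⇒I (weaken₂ (f x∈ y∈) · #1 · #0))

  disj-⊆ : ∀ {xs ys} → (∀ {x} → x ∈ xs → x ∈ ys) → Γ ⊩ disj xs ⇒ disj ys
  disj-⊆ xs⊆ys = disj-elim λ x∈ → disj-intro (xs⊆ys x∈)

  disj⇒⋁map : ∀ {f g : Fm → Fm} {b bs} → (∀ {x} → x ∈ b ∷ bs → Γ ⊩ x ⇒ f (g x)) →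
              Γ ⊩ disj (b ∷ bs) ⇒ ⋁map f (g b) (map g bs)
  disj⇒⋁map {bs = []}     h = ⇒I (∨E #0 (weaken₂ (h (here refl)) · #0) (⊥E #0))
  disj⇒⋁map {f = f} {g} {bs = c ∷ cs} h =
    ⇒I (∨E #0 (∨I₁ (weaken₂ (h (here refl)) · #0))
              (∨I₂ (weaken₂ (disj⇒⋁map {f = f} {g} (λ x∈ → h (there x∈))) · #0)))

  ⋁map⇒disj : ∀ {f g h : Fm → Fm} {b bs} → (∀ {x} → x ∈ b ∷ bs → Γ ⊩ f (g x) ⇒ h x) →
              Γ ⊩ ⋁map f (g b) (map g bs) ⇒ disj (map h (b ∷ bs))
  ⋁map⇒disj {bs = []}     k = ⇒I (∨I₁ (weaken₁ (k (here refl)) · #0))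
  ⋁map⇒disj {f = f} {g} {bs = c ∷ cs} k =
    ∨-mono (k (here refl)) (⋁map⇒disj {f = f} {g} (λ x∈ → k (there x∈)))

  choices-intro : ∀ as {bs} → (∀ {a} → a ∈ as → Γ ⊩ disj (map (a ⇒_) bs)) → Γ ⊩ disj (choices as bs)
  choices-intro []       h = ∨I₁ ⊤I
  choices-intro (a ∷ as) {bs} h =
    disj-elim₂ combine · h (here refl) · choices-intro as (λ a∈ → h (there a∈))
    where
      combine : ∀ {x y} → x ∈ map (a ⇒_) bs → y ∈ choices as bs →
                Γ ⊩ x ⇒ y ⇒ disj (choices (a ∷ as) bs)
      combine x∈ y∈ with b , b∈ , refl ← ∈-map⁻ (a ⇒_) x∈ =
        ⇒I (⇒I (disj-intro (∈-cartesianProductWith⁺ _ b∈ y∈) · ∧I #1 #0))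

  choices-elim : ∀ as {bs x a} → x ∈ choices as bs → a ∈ as → ∃[ b ] b ∈ bs × Γ ⊩ x ⇒ a ⇒ b
  choices-elim (a ∷ as) {bs} x∈ a∈ with ∈-cartesianProductWith⁻ _ bs (choices as bs) x∈ | a∈
  ... | b , c , b∈ , c∈ , refl | here refl = b , b∈ , ⇒I (∧E₁ #0)
  ... | b , c , b∈ , c∈ , refl | there a∈′
    with b′ , b′∈ , c⇒a⇒b′ ← choices-elim as c∈ a∈′ = b′ , b′∈ , ⇒I (weaken₁ c⇒a⇒b′ · ∧E₂ #0)

  θ-projective : ∀ {v} → Γ ⊩ α → ∀ χ → (Γ ⊩ sub (θ v α) χ ⇒ χ) × (Γ ⊩ χ ⇒ sub (θ v α) χ)
  θ-projective {v = v} ⊩α (var p) with v p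
  ... | true  = ⇒I (#0 · weaken₁ ⊩α) , ⇒I (⇒I #1)
  ... | false = ⇒I (∧E₂ #0) , ⇒I (∧I (weaken₁ ⊩α) #0)
  θ-projective ⊩α ⊥'       = I , I
  θ-projective ⊩α ⊤'       = I , I
  θ-projective ⊩α (A ∧' B) = zip′ ∧-mono ∧-mono (θ-projective ⊩α A) (θ-projective ⊩α B)
  θ-projective ⊩α (A ∨' B) = zip′ ∨-mono ∨-mono (θ-projective ⊩α A) (θ-projective ⊩α B)
  θ-projective ⊩α (A ⇒ B) with θ-projective ⊩α A | θ-projective ⊩α B
  ... | A⁻ , A⁺ | B⁻ , B⁺ = ⇒-mono A⁺ B⁻ , ⇒-mono A⁻ B⁺

  kalmar-∧ : ∀ a b → Γ ⊩ signed a A → Γ ⊩ signed b B → Γ ⊩ signed (a ∧ b) (A ∧' B)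
  kalmar-∧ true  true  ⊩A ⊩B = ∧I ⊩A ⊩B
  kalmar-∧ true  false ⊩A ⊩¬B = ⇒I (weaken₁ ⊩¬B · ∧E₂ #0)
  kalmar-∧ false b     ⊩¬A ⊩B = ⇒I (weaken₁ ⊩¬A · ∧E₁ #0)

  kalmar-∨ : ∀ a b → Γ ⊩ signed a A → Γ ⊩ signed b B → Γ ⊩ signed (a ∨ b) (A ∨' B)
  kalmar-∨ true  b     ⊩A ⊩B  = ∨I₁ ⊩A
  kalmar-∨ false true  ⊩¬A ⊩B = ∨I₂ ⊩B
  kalmar-∨ false false ⊩¬A ⊩¬B = ⇒I (∨E #0 (weaken₂ ⊩¬A · #0) (weaken₂ ⊩¬B · #0))

  kalmar-⇒ : ∀ a b → Γ ⊩ signed a A → Γ ⊩ signed b B → Γ ⊩ signed (not a ∨ b) (A ⇒ B)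
  kalmar-⇒ true  true  ⊩A ⊩B  = ⇒I (weaken₁ ⊩B)
  kalmar-⇒ true  false ⊩A ⊩¬B = ⇒I (weaken₁ ⊩¬B · (#0 · weaken₁ ⊩A))
  kalmar-⇒ false b     ⊩¬A ⊩B = ⇒I (⊥E (weaken₁ ⊩¬A · #0))

  kalmar : ∀ v χ → (∀ {p} → p ∈ vars χ → Γ ⊩ signed (v p) (var p)) → Γ ⊩ signed (eval v χ) χ
  kalmar v (var p)  lits = lits (here refl)
  kalmar v ⊥'       lits = I
  kalmar v ⊤'       lits = ⊤I
  kalmar v (A ∧' B) lits = kalmar-∧ (eval v A) (eval v B)
    (kalmar v A (λ p∈ → lits (∈-++⁺ˡ p∈))) (kalmar v B (λ p∈ → lits (∈-++⁺ʳ (vars A) p∈)))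
  kalmar v (A ∨' B) lits = kalmar-∨ (eval v A) (eval v B)
    (kalmar v A (λ p∈ → lits (∈-++⁺ˡ p∈))) (kalmar v B (λ p∈ → lits (∈-++⁺ʳ (vars A) p∈)))
  kalmar v (A ⇒ B)  lits = kalmar-⇒ (eval v A) (eval v B)
    (kalmar v A (λ p∈ → lits (∈-++⁺ˡ p∈))) (kalmar v B (λ p∈ → lits (∈-++⁺ʳ (vars A) p∈)))

  -- Case analysis on the variables ps not yet fixed by the assignment as.
  refute-or-satisfy-from : ∀ χ ps as → (∀ {p} → p ∈ vars χ → p ∈ ps ⊎ p ∈ domain as) →
                           Satisfiable χ ⊎ literals as ⊩ ¬' χ
  refute-or-satisfy-from χ [] as covered with eval (valuation as) χ in v⊨χ
  ... | true  = inj₁ (valuation as , v⊨χ)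
  ... | false = inj₂ (subst (λ b → literals as ⊩ signed b χ) v⊨χ
                  (kalmar (valuation as) χ λ p∈ →
                    hyp (literal-∈ as ([ (λ ()) , id ]′ (covered p∈)))))
  refute-or-satisfy-from χ (q ∷ ps) as covered
    with refute-or-satisfy-from χ ps ((q , true) ∷ as) (λ p∈ → move-head (covered p∈))
       | refute-or-satisfy-from χ ps ((q , false) ∷ as) (λ p∈ → move-head (covered p∈))
  ... | inj₁ sat | _        = inj₁ sat
  ... | inj₂ _   | inj₁ sat = inj₁ sat
  ... | inj₂ refuted-if-q | inj₂ refuted-if-¬q = inj₂ (¬-by-cases refuted-if-q refuted-if-¬q)

  refute-or-satisfy : ∀ χ → Satisfiable χ ⊎ Γ ⊩ ¬' χ
  refute-or-satisfy χ = map₂ (weaken λ ()) (refute-or-satisfy-from χ (vars χ) [] inj₁)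

  glivenko : CPC χ → Γ ⊩ ¬¬ χ
  glivenko {χ} taut with refute-or-satisfy (¬' χ)
  ... | inj₂ ⊩¬¬χ      = ⊩¬¬χ
  ... | inj₁ (v , v⊨¬χ) with () ← subst (λ b → not b ∨ false ≡ true) (taut v) v⊨¬χ

record NegativeTheory (S : FmSet) : Set where
  field
    mp-closed    : ∀ {φ ψ} → S (φ ⇒ ψ) → S φ → S ψ
    ipc⊆         : IPC ⊆ S
    atoms-stable : ∀ p → S (¬¬ (var p) ⇒ var p)

module Negative {S : FmSet} (S-negative : NegativeTheory S) where
  open NegativeTheory S-negative
  open Derivations S

  theorem : [] ⊩ φ → S φ
  theorem = derivable⇒member mp-closed ipc⊆

  stable : OrFree χ → Γ ⊩ ¬¬ χ ⇒ χ
  stable (var p)  = extra (atoms-stable p)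
  stable ⊥'       = ⇒I (#0 · I)
  stable ⊤'       = ⇒I ⊤I
  stable (a ∧' b) = ⇒I (∧I (stable a · (¬¬-map · ⇒I (∧E₁ #0) · #0))
                            (stable b · (¬¬-map · ⇒I (∧E₂ #0) · #0)))
  stable (a ⇒ b)  = ⇒I (⇒I (stable b · (¬¬-map · ⇒I (#0 · #1) · #1)))

  OrFree-tautology : OrFree χ → CPC χ → Γ ⊩ χ
  OrFree-tautology χ-free taut = stable χ-free · glivenko taut

  OrFree-⇒-by-θ : OrFree α → (∀ v → S (sub (θ v α) α) → S (sub (θ v α) ψ)) → S (α ⇒ ψ)
  OrFree-⇒-by-θ {α} {ψ} α-free θ-transfers with refute-or-satisfy α
  ... | inj₂ ⊩¬α = theorem (⇒I (⊥E (weaken₁ ⊩¬α · #0)))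
  ... | inj₁ (v , v⊨α) = theorem (⇒I (proj₁ (θ-projective #0 ψ) · extra S⊢θψ))
    where
      θα-free : OrFree (sub (θ v α) α)
      θα-free = sub-OrFree (θ v α) (θ-OrFree v α-free) α-free
      S⊢θψ : S (sub (θ v α) ψ)
      S⊢θψ = θ-transfers v (theorem (OrFree-tautology θα-free (θ-unifies v α v⊨α)))

  module _ (nd-axiom : ∀ φ ψ ψs → S (NDAxiom φ ψ ψs)) where

    OrFree-split : ∀ {a b bs} → OrFree a → (∀ {x} → x ∈ b ∷ bs → OrFree x) →
                   Γ ⊩ a ⇒ disj (b ∷ bs) → Γ ⊩ disj (map (a ⇒_) (b ∷ bs))
    OrFree-split {Γ} {a} {b} {bs} a-free bs-free a⇒bs =
      ⋁map⇒disj {f = λ χ → ¬¬ a ⇒ ¬' χ} {¬'} (λ x∈ → ¬¬-cancel (bs-free x∈))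
        · (extra (nd-axiom (¬' a) (¬' b) (map ¬' bs)) · ¬¬a⇒¬¬bs)
      where
        ¬¬a⇒¬¬bs : Γ ⊩ ¬¬ a ⇒ ⋁map ¬' (¬' b) (map ¬' bs)
        ¬¬a⇒¬¬bs = ⇒I (disj⇒⋁map (λ _ → ¬¬I) · (weaken₁ a⇒bs · (stable a-free · #0)))

        ¬¬-cancel : ∀ {x} → OrFree x → Γ ⊩ (¬¬ a ⇒ ¬¬ x) ⇒ a ⇒ x
        ¬¬-cancel x-free = ⇒I (⇒I (stable x-free · (#1 · (¬¬I · #0))))

    ⇒resolutions : ∀ φ → Γ ⊩ φ ⇒ disj (resolutions φ)
    resolution⇒  : ∀ φ → α ∈ resolutions φ → Γ ⊩ α ⇒ φ
    consequent⇒  : ∀ φ → α ∈ ⊥' ∷ resolutions φ → Γ ⊩ α ⇒ φ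

    ⇒resolutions (var p)  = ⇒I (∨I₁ #0)
    ⇒resolutions ⊥'       = ⇒I (∨I₁ #0)
    ⇒resolutions ⊤'       = ⇒I (∨I₁ #0)
    ⇒resolutions (A ∧' B) =
      ⇒I (disj-elim₂ pair · (⇒resolutions A · ∧E₁ #0) · (⇒resolutions B · ∧E₂ #0))
      where
        pair : ∀ {x y} → x ∈ resolutions A → y ∈ resolutions B →
               Δ ⊩ x ⇒ y ⇒ disj (resolutions (A ∧' B))
        pair x∈ y∈ = ⇒I (⇒I (disj-intro (∈-cartesianProductWith⁺ _∧'_ x∈ y∈) · ∧I #1 #0))
    ⇒resolutions (A ∨' B) =
      ⇒I (∨E #0 (disj-⊆ ∈-++⁺ˡ · (⇒resolutions A · #0)) (disj-⊆ (∈-++⁺ʳ _) · (⇒resolutions B · #0)))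
    ⇒resolutions (A ⇒ B)  = ⇒I (choices-intro (resolutions A) λ a∈ →
      OrFree-split (resolutions-OrFree A a∈) (consequents-OrFree B)
        (⇒I (∨I₂ (⇒resolutions B · (#1 · (resolution⇒ A a∈ · #0))))))

    resolution⇒ (var p) (here refl) = I
    resolution⇒ ⊥'      (here refl) = I
    resolution⇒ ⊤'      (here refl) = I
    resolution⇒ (A ∧' B) α∈
      with x , y , x∈ , y∈ , refl ← ∈-cartesianProductWith⁻ _∧'_ (resolutions A) (resolutions B) α∈ =
      ∧-mono (resolution⇒ A x∈) (resolution⇒ B y∈)
    resolution⇒ (A ∨' B) α∈ with ∈-++⁻ (resolutions A) α∈
    ... | inj₁ α∈A = ⇒I (∨I₁ (resolution⇒ A α∈A · #0))
    ... | inj₂ α∈B = ⇒I (∨I₂ (resolution⇒ B α∈B · #0))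
    resolution⇒ {α = α} {Γ = Γ} (A ⇒ B) α∈ =
      ⇒I (⇒I (disj-elim apply-choice · (⇒resolutions A · #0)))
      where
        apply-choice : ∀ {a} → a ∈ resolutions A → A ∷ α ∷ Γ ⊩ a ⇒ B
        apply-choice a∈ with b , b∈ , α⇒a⇒b ← choices-elim (resolutions A) α∈ a∈ =
          ⇒I (consequent⇒ B b∈ · (α⇒a⇒b · #2 · #0))

    consequent⇒ φ (here refl) = ⇒I (⊥E #0)
    consequent⇒ φ (there α∈)  = resolution⇒ φ α∈

    ⇒-by-resolutions : ∀ φ → (∀ {α} → α ∈ resolutions φ → S (α ⇒ ψ)) → S (φ ⇒ ψ)
    ⇒-by-resolutions φ α⇒ψ =
      theorem (⇒I (disj-elim (λ α∈ → extra (α⇒ψ α∈)) · (⇒resolutions φ · #0)))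

¬¬¬var⇒¬var : ∀ p → IPC (¬¬ (¬' (var p)) ⇒ ¬' (var p))
¬¬¬var⇒¬var p = Derivations.derivable⇒member IPC ipc-mp id (Derivations.¬¬¬⇒¬ IPC)

negative-variant : ∀ {L} → IntermediateLogic L → NegativeTheory (L ⁻)
negative-variant L-logic = record
  { mp-closed    = mp-closed
  ; ipc⊆         = λ d → ipc⊆ (IPC-sub (λ p → ¬' (var p)) d)
  ; atoms-stable = λ p → ipc⊆ (¬¬¬var⇒¬var p)
  }
  where open IntermediateTheory (IntermediateLogic.theory L-logic)

negative-variant-ND : ∀ {L} → ND ⊆ L → ∀ φ ψ ψs → (L ⁻) (NDAxiom φ ψ ψs)
negative-variant-ND ND⊆L φ ψ ψs = ND⊆L (nd-sub (λ p → ¬' (var p)) (nd-ax φ ψ ψs))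

θ-stable : ∀ {L α} → IntermediateLogic L → OrFree α → ∀ v → Stable L (θ v α)
θ-stable {L} {α} L-logic α-free v p =
  theorem {φ = θ v α p ⇔ ¬¬ (θ v α p)} (∧I ¬¬I (stable (θ-OrFree v α-free p)))
  where
    open Derivations (L ⁻)
    open Negative (negative-variant L-logic)

theorem5p5 : (L : FmSet) → IntermediateLogic L → ND ⊆ L →
    (T : FmSet) → IntermediateTheory T → (L ⁻) ⊆ T →
    (∀ σ → Stable L σ → ClosedUnder T σ) →
    (φ ψ : Fm) →
    (∀ σ → Stable L σ → T (sub σ φ) → T (sub σ ψ)) →
    φ ⊢[ T ] ψ
theorem5p5 L L-logic ND⊆L T T-theory L⁻⊆T T-closed φ ψ stable-transfer =
  ⇒-consequence (⇒-by-resolutions T-nd φ resolution⇒ψ)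
  where
    T-negative : NegativeTheory T
    T-negative = record
      { mp-closed    = IntermediateTheory.mp-closed T-theory
      ; ipc⊆         = IntermediateTheory.ipc⊆ T-theory
      ; atoms-stable = λ p → L⁻⊆T (NegativeTheory.atoms-stable (negative-variant L-logic) p)
      }
    open Negative T-negative

    T-nd : ∀ a b bs → T (NDAxiom a b bs)
    T-nd a b bs = L⁻⊆T (negative-variant-ND ND⊆L a b bs)

    resolution⇒ψ : ∀ {α} → α ∈ resolutions φ → T (α ⇒ ψ)
    resolution⇒ψ {α} α∈ = OrFree-⇒-by-θ α-free λ v T⊢θα →
      let θ-stable-v = θ-stable L-logic α-free v
          α⊢φ        = ⇒-consequence (theorem (resolution⇒ T-nd φ α∈))
      in stable-transfer _ θ-stable-v (discharge-premise T-theory T⊢θα (T-closed _ θ-stable-v α φ α⊢φ))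
      where α-free = resolutions-OrFree φ α∈
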